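{- Let $\pi\in S_n$ have pinnacle set $S$ with $|S|=p\ge 1$. There is a sequence of at most $p-1$ reversals, each balanced for the permutation to which it is applied, transforming $\pi$ into a permutation $\pi^*$ with pinnacle set $S$ such that the leftmost pinnacle $y^*_1$ of $\pi^*$ is the smallest element of $S$. Moreover, when $p\ge 3$, exactly one of the following occurs: (X) the sequence contains exactly $p-1$ balanced reversals and the rightmost pinnacle $y^*_p$ of $\pi^*$ is the largest element of $S$; (Y) the sequence contains at most $p-2$ balanced reversals.
   Context: Convention: a permutation $\pi=(\pi_1\,\ldots\,\pi_n)\in S_n$ is always extended by $\pi_0=n+1$ and $\pi_{n+1}=n+2$. A pinnacle of $\pi$ is an element $\pi_i$ with $1\le i\le n$ and $\pi_{i-1}<\pi_i>\pi_{i+1}$; the pinnacle set is the set of pinnacles. If $\pi^*$ has $p$ pinnacles, $y^*_1,\ldots,y^*_p$ denote them in left-to-right order. For elements $w_1=\pi_a$, $w_2=\pi_b$ with $1\le a\le b\le n$, the reversal $\rho(w_1,w_2)$ transforms $\pi$ into $\pi\cdot\rho(w_1,w_2)=(\pi_0\ldots\pi_{a-1}\,\pi_b\,\pi_{b-1}\ldots\pi_a\,\pi_{b+1}\ldots\pi_{n+1})$. It is balanced for $\pi$ if $\pi$ and $\pi\cdot\rho(w_1,w_2)$ have the same pinnacle set. -}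

module Defs where

open import Data.Nat using (ℕ; zero; suc; _≤_; _<_; _<ᵇ_)
open import Data.Bool using (if_then_else_; _∧_)
open import Data.Product using (_×_; _,_)
open import Data.List using (List; []; _∷_; _++_; map; upTo; take; drop; reverse)
open import Data.List.Membership.Propositional using (_∈_)
open import Data.List.Relation.Binary.Permutation.Propositional using (_↭_)

IsPerm : ℕ → List ℕ → Set
IsPerm n π = π ↭ map suc (upTo n)

ext : ℕ → List ℕ → List ℕ
ext n π = suc n ∷ (π ++ (suc (suc n) ∷ []))

peaks : List ℕ → List ℕ
peaks (a ∷ b ∷ c ∷ rest) =
  if (a <ᵇ b) ∧ (c <ᵇ b) then b ∷ peaks (b ∷ c ∷ rest) else peaks (b ∷ c ∷ rest)
peaks _ = []

-- The pinnacles y_1, …, y_p of π ∈ S_n in left-to-right order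
-- (interior positions of the extended word are exactly positions 1..n).
pinnacles : ℕ → List ℕ → List ℕ
pinnacles n π = peaks (ext n π)

SameSet : List ℕ → List ℕ → Set
SameSet A B = (∀ v → v ∈ A → v ∈ B) × (∀ v → v ∈ B → v ∈ A)

-- Reversal of the segment of positions i+1 … j+1 (1-based), i.e. 0-based i … j.
-- With a = i+1, b = j+1, w₁ = π_a, w₂ = π_b this is π · ρ(w₁, w₂).
revSeg : ℕ → ℕ → List ℕ → List ℕ
revSeg i j π = take i π ++ (reverse (drop i (take (suc j) π)) ++ drop (suc j) π)

Balanced : ℕ → ℕ → ℕ → List ℕ → Set
Balanced n i j π = SameSet (pinnacles n π) (pinnacles n (revSeg i j π))

data BalSeq (n : ℕ) : List ℕ → List (ℕ × ℕ) → List ℕ → Set where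
  done : ∀ {π} → BalSeq n π [] π
  step : ∀ {π π* i j rs} → i ≤ j → j < n → Balanced n i j π →
         BalSeq n (revSeg i j π) rs π* → BalSeq n π ((i , j) ∷ rs) π*

IsMinOf : ℕ → List ℕ → Set
IsMinOf y S = y ∈ S × (∀ s → s ∈ S → y ≤ s)

IsMaxOf : ℕ → List ℕ → Set
IsMaxOf y S = y ∈ S × (∀ s → s ∈ S → s ≤ y)

-- Let a be the first valley of π, where the descent from π₀ = n+1 ends. Reversing the
-- segment from a to the valley after the pinnacle y_j reverses y₁ … y_j and keeps the later
-- pinnacles, provided y_{j+1} > a: that valley then follows the initial descent and a sits
-- between a larger letter and y_{j+1}, so no pinnacle is created or destroyed. To bring the
-- minimum m = y_k to the front take the least j ≥ k with y_{j+1} > a (or j = p). If j = k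
-- one reversal suffices; otherwise y_j ≤ a, the new first valley lies below y_j, and the
-- number of pinnacles below the first valley drops. So at most max(1, #{i ≥ 2 : y_i ≤ a})
-- ≤ p − 1 reversals are used, and for p ≥ 3 fewer than p − 1 unless y₂, …, y_p all lie
-- below a < y₁. In that case one first reverses all pinnacles, which puts the maximum y₁
-- last, out of reach of every later reversal.
module Submission where

open import Defs
open import Data.Bool using (true; false; if_then_else_; _∧_)
open import Data.Bool.Properties using (∧-comm; ∧-zeroʳ)
open import Data.Empty using (⊥)
open import Data.Unit using (⊤)
open import Data.List using (List; []; _∷_; _++_; [_]; _∷ʳ_; reverse; take; drop; length; upTo; filter)
open import Data.List.Properties
  using ( ++-assoc; reverse-++; ∷-injectiveˡ; ∷-injectiveʳ; length-++; length-map; length-upTo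
        ; ++-conicalˡ; ++-conicalʳ; length-++-≤ˡ; ∷ʳ-injectiveʳ
        ; filter-++; length-filter; filter-accept; filter-reject; ∷ʳ-++; ++-identityʳ; ∷ʳ-injective
        ; unfold-reverse; length-reverse)
open import Data.List.Membership.Propositional using (_∈_)
open import Data.List.Membership.Propositional.Properties using (∈-∃++; ∈-++⁺ˡ; ∈-++⁺ʳ)
open import Data.List.Relation.Binary.Permutation.Propositional
  using (_↭_; ↭-sym; ↭-trans; ↭-reflexive; ↭⇒↭ₛ)
open import Data.List.Relation.Binary.Permutation.Propositional.Properties
  using (All-resp-↭; ∈-resp-↭; ↭-length; ↭-reverse; zoom; filter-↭; ++⁺ʳ)
open import Data.List.Relation.Unary.All as All using (All; []; _∷_)
import Data.List.Relation.Unary.All.Properties as AllP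
open import Data.List.Relation.Unary.AllPairs using ([]; _∷_)
open import Data.List.Relation.Unary.Any using (here; there)
open import Data.List.Relation.Unary.Linked as Linked using (Linked; []; [-]; _∷_)
open import Data.List.Relation.Unary.Linked.Properties using (AllPairs⇒Linked)
open import Data.List.Relation.Unary.Unique.Propositional using (Unique)
import Data.List.Relation.Unary.Unique.Propositional.Properties as Unique
open import Data.Nat using (ℕ; zero; suc; _+_; _∸_; _⊔_; _≤_; _<_; _>_; _<ᵇ_; _<?_; _≤?_; z≤n; s≤s)
open import Data.Nat.Properties
  using ( _≟_; ≤-refl; ≤-reflexive; ≤-trans; ≤-pred; <-irrefl; <-trans; <-asym; <-cmp
        ; <-≤-trans; ≤-<-trans; <⇒≤; <⇒≢; <⇒≯; <⇒≱; ≰⇒>; ≮⇒≥; ≤∧≢⇒<; n<1+n; n≤1+n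
        ; m≤n⇒m≤1+n; m≤m+n; m≤n+m; suc-injective; +-mono-≤-<; +-identityʳ; m+[n∸m]≡n
        ; m≤m⊔n; m≤n⊔m; ⊔-lub; pred[m∸n]≡m∸[1+n]; suc[m]≤n⇒m≤pred[n]; <ᵇ-reflects-<
        ; module ≤-Reasoning )
open import Data.Product using (Σ-syntax; _×_; _,_; proj₁; proj₂)
open import Data.Sum using (_⊎_; inj₁; inj₂)
open import Function using (_∘_)
open import Relation.Binary.Definitions using (tri<; tri≈; tri>)
open import Relation.Binary.PropositionalEquality hiding ([_])
open import Relation.Binary.PropositionalEquality.Properties using () renaming (setoid to ≡-setoid)
open import Relation.Nullary using (¬_; contradiction; yes; no)
open import Relation.Nullary.Reflects using (ofʸ; ofⁿ)
open import Data.List.Relation.Binary.Permutation.Setoid.Properties (≡-setoid ℕ) using (Unique-resp-↭)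

length-∷ʳ : ∀ {A : Set} (xs : List A) {x} → length (xs ∷ʳ x) ≡ suc (length xs)
length-∷ʳ []       = refl
length-∷ʳ (_ ∷ xs) = cong suc (length-∷ʳ xs)

++-cancel-length : ∀ {A : Set} (xs us : List A) {ys vs} → length xs ≡ length us →
                   xs ++ ys ≡ us ++ vs → xs ≡ us × ys ≡ vs
++-cancel-length []       []       _   eq = refl , eq
++-cancel-length []       (_ ∷ _)  ()  _
++-cancel-length (_ ∷ _)  []       ()  _
++-cancel-length (x ∷ xs) (u ∷ us) len eq with ++-cancel-length xs us (suc-injective len) (∷-injectiveʳ eq)
... | refl , ys≡vs = cong (_∷ xs) (∷-injectiveˡ eq) , ys≡vs

∷ʳ-≡-++ : ∀ {A : Set} xs ys {z r : A} zs → xs ∷ʳ z ≡ ys ++ r ∷ zs →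
          Σ[ W ∈ List A ] (xs ≡ ys ++ W × r ∷ zs ≡ W ∷ʳ z)
∷ʳ-≡-++ xs       []       zs eq = xs , refl , sym eq
∷ʳ-≡-++ []       (_ ∷ ys) zs eq = contradiction (++-conicalʳ ys _ (sym (∷-injectiveʳ eq))) λ ()
∷ʳ-≡-++ (x ∷ xs) (_ ∷ ys) zs eq with ∷ʳ-≡-++ xs ys zs (∷-injectiveʳ eq)
... | W , xs≡ , r∷zs≡ = W , cong₂ _∷_ (∷-injectiveˡ eq) xs≡ , r∷zs≡

unsnoc : ∀ {A : Set} (x : A) xs → Σ[ P ∈ List A ] Σ[ y ∈ A ] x ∷ xs ≡ P ∷ʳ y
unsnoc x []        = [] , x , refl
unsnoc x (x′ ∷ xs) with unsnoc x′ xs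
... | P , y , eq = x ∷ P , y , cong (x ∷_) eq

take-length-++ : ∀ {A : Set} (xs ys : List A) → take (length xs) (xs ++ ys) ≡ xs
take-length-++ []       ys = refl
take-length-++ (x ∷ xs) ys = cong (x ∷_) (take-length-++ xs ys)

drop-length-++ : ∀ {A : Set} (xs ys : List A) → drop (length xs) (xs ++ ys) ≡ ys
drop-length-++ []       ys = refl
drop-length-++ (x ∷ xs) ys = drop-length-++ xs ys

Linked-∷ʳ⁻ : ∀ {A : Set} {R : A → A → Set} xs {v} → Linked R (xs ∷ʳ v) → Linked R xs
Linked-∷ʳ⁻ []          _         = []
Linked-∷ʳ⁻ (_ ∷ [])    _         = [-]
Linked-∷ʳ⁻ (_ ∷ _ ∷ xs) (r ∷ rs) = r ∷ Linked-∷ʳ⁻ (_ ∷ xs) rs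

Linked-++⁻ʳ : ∀ {A : Set} {R : A → A → Set} xs {ys} → Linked R (xs ++ ys) → Linked R ys
Linked-++⁻ʳ []       linked = linked
Linked-++⁻ʳ (_ ∷ xs) linked = Linked-++⁻ʳ xs (Linked.tail linked)

-- Peaks of words

<ᵇ≡true : ∀ {m n} → m < n → (m <ᵇ n) ≡ true
<ᵇ≡true {m} {n} m<n with m <ᵇ n | <ᵇ-reflects-< m n
... | true  | _        = refl
... | false | ofⁿ m≮n = contradiction m<n m≮n

<ᵇ≡false : ∀ {m n} → ¬ m < n → (m <ᵇ n) ≡ false
<ᵇ≡false {m} {n} m≮n with m <ᵇ n | <ᵇ-reflects-< m n
... | false | _        = refl
... | true  | ofʸ m<n = contradiction m<n m≮n

peak : ℕ → ℕ → ℕ → List ℕ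
peak a b c = if (a <ᵇ b) ∧ (c <ᵇ b) then [ b ] else []

peak-yes : ∀ {a b c} → a < b → c < b → peak a b c ≡ [ b ]
peak-yes a<b c<b rewrite <ᵇ≡true a<b | <ᵇ≡true c<b = refl

peak-noˡ : ∀ {a b c} → ¬ a < b → peak a b c ≡ []
peak-noˡ a≮b rewrite <ᵇ≡false a≮b = refl

peak-noʳ : ∀ {a b c} → ¬ c < b → peak a b c ≡ []
peak-noʳ {a} {b} c≮b rewrite <ᵇ≡false c≮b | ∧-zeroʳ (a <ᵇ b) = refl

peak-sym : ∀ a b c → peak a b c ≡ peak c b a
peak-sym a b c rewrite ∧-comm (a <ᵇ b) (c <ᵇ b) = refl

reverse-peak : ∀ a b c → reverse (peak a b c) ≡ peak a b c
reverse-peak a b c with (a <ᵇ b) ∧ (c <ᵇ b)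
... | true  = refl
... | false = refl

peaks-∷ : ∀ x w → peaks (x ∷ w) ≡ peaks (x ∷ take 2 w) ++ peaks w
peaks-∷ x []          = refl
peaks-∷ x (_ ∷ [])    = refl
peaks-∷ x (u ∷ v ∷ _) with (x <ᵇ u) ∧ (v <ᵇ u)
... | true  = refl
... | false = refl

take-2-++ : ∀ xs (a b : ℕ) ws → take 2 (xs ++ a ∷ b ∷ ws) ≡ take 2 (xs ++ a ∷ b ∷ [])
take-2-++ []          a b ws = refl
take-2-++ (_ ∷ [])    a b ws = refl
take-2-++ (_ ∷ _ ∷ _) a b ws = refl

peaks-++ : ∀ xs a b ws → peaks (xs ++ a ∷ b ∷ ws) ≡ peaks (xs ++ a ∷ b ∷ []) ++ peaks (a ∷ b ∷ ws)
peaks-++ []       a b ws = refl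
peaks-++ (x ∷ xs) a b ws = begin
  peaks (x ∷ xs ++ a ∷ b ∷ ws)
    ≡⟨ peaks-∷ x (xs ++ a ∷ b ∷ ws) ⟩
  peaks (x ∷ take 2 (xs ++ a ∷ b ∷ ws)) ++ peaks (xs ++ a ∷ b ∷ ws)
    ≡⟨ cong₂ (λ u v → peaks (x ∷ u) ++ v) (take-2-++ xs a b ws) (peaks-++ xs a b ws) ⟩
  peaks (x ∷ take 2 (xs ++ a ∷ b ∷ [])) ++ (peaks (xs ++ a ∷ b ∷ []) ++ peaks (a ∷ b ∷ ws))
    ≡⟨ ++-assoc (peaks (x ∷ take 2 (xs ++ a ∷ b ∷ []))) _ _ ⟨
  (peaks (x ∷ take 2 (xs ++ a ∷ b ∷ [])) ++ peaks (xs ++ a ∷ b ∷ [])) ++ peaks (a ∷ b ∷ ws)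
    ≡⟨ cong (_++ peaks (a ∷ b ∷ ws)) (peaks-∷ x (xs ++ a ∷ b ∷ [])) ⟨
  peaks (x ∷ xs ++ a ∷ b ∷ []) ++ peaks (a ∷ b ∷ ws) ∎
  where open ≡-Reasoning

peaks-reverse : ∀ w → peaks (reverse w) ≡ reverse (peaks w)
peaks-reverse []              = refl
peaks-reverse (_ ∷ [])        = refl
peaks-reverse (_ ∷ _ ∷ [])    = refl
peaks-reverse (a ∷ b ∷ c ∷ r) = begin
  peaks (reverse (a ∷ b ∷ c ∷ r))
    ≡⟨ cong peaks (reverse-++ (a ∷ b ∷ c ∷ []) r) ⟩
  peaks (reverse r ++ c ∷ b ∷ a ∷ [])
    ≡⟨ peaks-++ (reverse r) c b (a ∷ []) ⟩
  peaks (reverse r ++ c ∷ b ∷ []) ++ peak c b a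
    ≡⟨ cong₂ _++_ (cong peaks (reverse-++ (b ∷ c ∷ []) r)) (peak-sym a b c) ⟨
  peaks (reverse (b ∷ c ∷ r)) ++ peak a b c
    ≡⟨ cong₂ _++_ (peaks-reverse (b ∷ c ∷ r)) (sym (reverse-peak a b c)) ⟩
  reverse (peaks (b ∷ c ∷ r)) ++ reverse (peak a b c)
    ≡⟨ reverse-++ (peak a b c) (peaks (b ∷ c ∷ r)) ⟨
  reverse (peak a b c ++ peaks (b ∷ c ∷ r))
    ≡⟨ cong reverse (peaks-∷ a (b ∷ c ∷ r)) ⟨
  reverse (peaks (a ∷ b ∷ c ∷ r)) ∎
  where open ≡-Reasoning

peaks-descent : ∀ {a b} r → b < a → peaks (a ∷ b ∷ r) ≡ peaks (b ∷ r)
peaks-descent []      b<a = refl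
peaks-descent {a} {b} (c ∷ r) b<a =
  trans (peaks-∷ a (b ∷ c ∷ r)) (cong (_++ peaks (b ∷ c ∷ r)) (peak-noˡ (<⇒≯ b<a)))

peaks-no-peakʳ : ∀ {a b c} r → ¬ c < b → peaks (a ∷ b ∷ c ∷ r) ≡ peaks (b ∷ c ∷ r)
peaks-no-peakʳ {a} {b} {c} r c≮b =
  trans (peaks-∷ a (b ∷ c ∷ r)) (cong (_++ peaks (b ∷ c ∷ r)) (peak-noʳ c≮b))

peaks-ascent : ∀ {a b c} r → b < c → peaks (a ∷ b ∷ c ∷ r) ≡ peaks (b ∷ c ∷ r)
peaks-ascent r b<c = peaks-no-peakʳ r (<⇒≯ b<c)

peaks-peak : ∀ {a b c} r → a < b → c < b → peaks (a ∷ b ∷ c ∷ r) ≡ b ∷ peaks (b ∷ c ∷ r)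
peaks-peak {a} {b} {c} r a<b c<b =
  trans (peaks-∷ a (b ∷ c ∷ r)) (cong (_++ peaks (b ∷ c ∷ r)) (peak-yes a<b c<b))

peaks-descending-++-ascent : ∀ D {v q} → Linked _>_ D → v < q → peaks (D ++ v ∷ q ∷ []) ≡ []
peaks-descending-++-ascent []          _            v<q = refl
peaks-descending-++-ascent (x ∷ [])    _            v<q = peaks-ascent [] v<q
peaks-descending-++-ascent (x ∷ y ∷ D) (y<x ∷ desc) v<q =
  trans (peaks-descent (D ++ _) y<x) (peaks-descending-++-ascent (y ∷ D) desc v<q)

peaks-head-above : ∀ {a b} r {y ys} → a < b → Linked _≢_ (b ∷ r) → peaks (a ∷ b ∷ r) ≡ y ∷ ys → a < y
peaks-head-above []      a<b _                  ()
peaks-head-above {b = b} (c ∷ r) a<b (b≢c ∷ distinct) eq with <-cmp b c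
... | tri< b<c _ _ = <-trans a<b (peaks-head-above r b<c distinct (trans (sym (peaks-ascent r b<c)) eq))
... | tri≈ _ b≡c _ = contradiction b≡c b≢c
... | tri> _ _ c<b = subst (_ <_) (∷-injectiveˡ (trans (sym (peaks-peak r a<b c<b)) eq)) a<b

HeadAbove : ℕ → List ℕ → Set
HeadAbove a []      = ⊤
HeadAbove a (y ∷ _) = a < y

peaks-replace-valley : ∀ {a v r₀} Z → v < r₀ → HeadAbove a (peaks (v ∷ r₀ ∷ Z)) →
                       peaks (a ∷ r₀ ∷ Z) ≡ peaks (v ∷ r₀ ∷ Z)
peaks-replace-valley []      v<r₀ _ = refl
peaks-replace-valley {a} (z ∷ Z) v<r₀ above with z <? _
... | yes z<r₀ = trans (peaks-peak Z (subst (HeadAbove a) v-peaks above) z<r₀) (sym v-peaks)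
  where v-peaks = peaks-peak Z v<r₀ z<r₀
... | no  z≮r₀ = trans (peaks-no-peakʳ Z z≮r₀) (sym (peaks-no-peakʳ Z z≮r₀))

-- After the reversal v follows the descent R and a sits between b > a and r₀; neither is
-- a peak, and r₀ is one exactly when it was before because it exceeds a.
peaks-reverse-valleys : ∀ R {a b} body front {q v r₀} tail → Linked _>_ R → a < b →
  a ∷ b ∷ body ≡ front ++ q ∷ v ∷ [] → v < q → v < r₀ → HeadAbove a (peaks (v ∷ r₀ ∷ tail)) →
  peaks (R ++ reverse (a ∷ b ∷ body) ++ r₀ ∷ tail)
    ≡ reverse (peaks (a ∷ b ∷ body)) ++ peaks (v ∷ r₀ ∷ tail)
peaks-reverse-valleys R {a} {b} body front {q} {v} {r₀} tail desc a<b ends v<q v<r₀ above = begin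
  peaks (R ++ reverse Y ++ Z)                                 ≡⟨ cong (λ w → peaks (R ++ w ++ Z)) rev-front ⟩
  peaks (R ++ v ∷ q ∷ reverse front ++ Z)                     ≡⟨ peaks-++ R v q _ ⟩
  peaks (R ++ v ∷ q ∷ []) ++ peaks (v ∷ q ∷ reverse front ++ Z)
    ≡⟨ cong (_++ peaks (v ∷ q ∷ reverse front ++ Z)) (peaks-descending-++-ascent R desc v<q) ⟩
  peaks (v ∷ q ∷ reverse front ++ Z)                          ≡⟨ cong (λ w → peaks (w ++ Z)) rev-front ⟨
  peaks (reverse Y ++ Z)                                      ≡⟨ cong (λ w → peaks (w ++ Z)) rev-body ⟩
  peaks ((reverse body ++ b ∷ a ∷ []) ++ Z)                   ≡⟨ cong peaks (++-assoc (reverse body) _ Z) ⟩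
  peaks (reverse body ++ b ∷ a ∷ Z)                           ≡⟨ peaks-++ (reverse body) b a Z ⟩
  peaks (reverse body ++ b ∷ a ∷ []) ++ peaks (b ∷ a ∷ Z)
    ≡⟨ cong₂ _++_ (cong peaks (sym rev-body)) (peaks-descent Z a<b) ⟩
  peaks (reverse Y) ++ peaks (a ∷ Z)
    ≡⟨ cong₂ _++_ (peaks-reverse Y) (peaks-replace-valley tail v<r₀ above) ⟩
  reverse (peaks Y) ++ peaks (v ∷ Z)                          ∎
  where
  open ≡-Reasoning
  Y = a ∷ b ∷ body
  Z = r₀ ∷ tail
  rev-front : reverse Y ≡ v ∷ q ∷ reverse front
  rev-front = trans (cong reverse ends) (reverse-++ front (q ∷ v ∷ []))
  rev-body : reverse Y ≡ reverse body ++ b ∷ a ∷ []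
  rev-body = reverse-++ (a ∷ b ∷ []) body

-- True of extended words, whose last letter n+2 is the largest; it guarantees that every
-- descent ends in a valley.
EndsAscending : List ℕ → Set
EndsAscending (a ∷ b ∷ [])        = a < b
EndsAscending (_ ∷ w@(_ ∷ _ ∷ _)) = EndsAscending w
EndsAscending _                   = ⊥

EndsAscending-∷ : ∀ x w → EndsAscending w → EndsAscending (x ∷ w)
EndsAscending-∷ x (_ ∷ _ ∷ [])    ends = ends
EndsAscending-∷ x (_ ∷ _ ∷ _ ∷ _) ends = ends

EndsAscending-∷ʳ : ∀ x w {z} → All (_< z) (x ∷ w) → EndsAscending (x ∷ w ∷ʳ z)
EndsAscending-∷ʳ x []      (x<z ∷ []) = x<z
EndsAscending-∷ʳ x (y ∷ w) (_ ∷ below) = EndsAscending-∷ x (y ∷ w ∷ʳ _) (EndsAscending-∷ʳ y w below)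

EndsAscending-++⁻ : ∀ X {a b} r → EndsAscending (X ++ a ∷ b ∷ r) → EndsAscending (a ∷ b ∷ r)
EndsAscending-++⁻ []               r ends = ends
EndsAscending-++⁻ (_ ∷ [])         r ends = ends
EndsAscending-++⁻ (_ ∷ y ∷ [])     r ends = ends
EndsAscending-++⁻ (_ ∷ y ∷ z ∷ X)  r ends = EndsAscending-++⁻ (y ∷ z ∷ X) r ends

-- Cutting a word after the valley following its j-th peak

raise-head-last-above : ∀ {b c v y} L P → c < b → c ∷ L ≡ P ∷ʳ y → v < y →
               Σ[ P′ ∈ List ℕ ] Σ[ y′ ∈ ℕ ] (b ∷ L ≡ P′ ∷ʳ y′ × v < y′)
raise-head-last-above L []      c<b eq v<y = [] , _ , cong (_ ∷_) (∷-injectiveʳ eq) ,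
                                    <-trans (subst (_ <_) (sym (∷-injectiveˡ eq)) v<y) c<b
raise-head-last-above L (p ∷ P) c<b eq v<y = _ ∷ P , _ , cong (_ ∷_) (∷-injectiveʳ eq) , v<y

-- If the word starts with a descent, pending = [ a ] and a stands in for the last peak
-- before v.
record ValleyCut (pending : List ℕ) (a b : ℕ) (r : List ℕ) (j : ℕ) : Set where
  constructor valleyCut
  field
    body front tail : List ℕ
    q v r₀          : ℕ
    ends-in-valley  : a ∷ b ∷ body ≡ front ++ q ∷ v ∷ []
    cut             : r ≡ body ++ r₀ ∷ tail
    v<q             : v < q
    v<r₀            : v < r₀
    peaks-cut       : peaks (a ∷ b ∷ r) ≡ peaks (a ∷ b ∷ body) ++ peaks (v ∷ r₀ ∷ tail)
    count           : length (peaks (a ∷ b ∷ body)) ≡ j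
    earlier         : List ℕ
    last            : ℕ
    last-split      : pending ++ peaks (a ∷ b ∷ body) ≡ earlier ∷ʳ last
    v<last          : v < last

extendCut : ∀ {pending pending′ a b c r j j′} extra →
            (∀ w → peaks (a ∷ b ∷ c ∷ w) ≡ extra ++ peaks (b ∷ c ∷ w)) →
            length extra + j ≡ j′ →
            (C : ValleyCut pending b c r j) →
            (let open ValleyCut C in
             Σ[ P ∈ List ℕ ] Σ[ y ∈ ℕ ] (pending′ ++ extra ++ peaks (b ∷ c ∷ body) ≡ P ∷ʳ y × v < y)) →
            ValleyCut pending′ a b (c ∷ r) j′
extendCut {pending′ = pending′} {a} {b} {c} {r} extra peaks-shift count′
          (valleyCut body front tail q v r₀ ends cut v<q v<r₀ peaks-cut count _ _ _ _)
          (earlier , last , last-split , v<last) =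
  valleyCut (c ∷ body) (a ∷ front) tail q v r₀ (cong (a ∷_) ends) (cong (c ∷_) cut) v<q v<r₀
            peaks-cut′ count″ earlier last
            (trans (cong (pending′ ++_) (peaks-shift body)) last-split) v<last
  where
  open ≡-Reasoning
  peaks-cut′ : peaks (a ∷ b ∷ c ∷ r) ≡ peaks (a ∷ b ∷ c ∷ body) ++ peaks (v ∷ r₀ ∷ tail)
  peaks-cut′ = begin
    peaks (a ∷ b ∷ c ∷ r)                                   ≡⟨ peaks-shift r ⟩
    extra ++ peaks (b ∷ c ∷ r)                              ≡⟨ cong (extra ++_) peaks-cut ⟩
    extra ++ (peaks (b ∷ c ∷ body) ++ peaks (v ∷ r₀ ∷ tail)) ≡⟨ ++-assoc extra _ _ ⟨
    (extra ++ peaks (b ∷ c ∷ body)) ++ peaks (v ∷ r₀ ∷ tail) ≡⟨ cong (_++ _) (peaks-shift body) ⟨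
    peaks (a ∷ b ∷ c ∷ body) ++ peaks (v ∷ r₀ ∷ tail)        ∎
  count″ : length (peaks (a ∷ b ∷ c ∷ body)) ≡ _
  count″ = begin
    length (peaks (a ∷ b ∷ c ∷ body))      ≡⟨ cong length (peaks-shift body) ⟩
    length (extra ++ peaks (b ∷ c ∷ body)) ≡⟨ length-++ extra ⟩
    length extra + length (peaks (b ∷ c ∷ body)) ≡⟨ cong (length extra +_) count ⟩
    length extra + _                       ≡⟨ count′ ⟩
    _                                      ∎

valleyCut↑ : ∀ j a b r → a < b → Linked _≢_ (b ∷ r) → EndsAscending (a ∷ b ∷ r) →
             suc j ≤ length (peaks (a ∷ b ∷ r)) → ValleyCut [] a b r (suc j)
valleyCut↓ : ∀ j a b r → b < a → Linked _≢_ (b ∷ r) → EndsAscending (a ∷ b ∷ r) →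
             j ≤ length (peaks (a ∷ b ∷ r)) → ValleyCut [ a ] a b r j

valleyCut↑ j a b []      a<b _                  _    ()
valleyCut↑ j a b (c ∷ r) a<b (b≢c ∷ distinct) ends j< with <-cmp b c
... | tri≈ _ b≡c _ = contradiction b≡c b≢c
... | tri< b<c _ _ =
  let C = valleyCut↑ j b c r b<c distinct ends (subst (λ l → suc j ≤ length l) (peaks-ascent r b<c) j<)
      open ValleyCut C
  in extendCut [] (λ w → peaks-ascent w b<c) refl C
       (earlier , last , last-split , v<last)
... | tri> _ _ c<b =
  let C = valleyCut↓ j b c r c<b distinct ends (≤-pred (subst (λ l → suc j ≤ length l) (peaks-peak r a<b c<b) j<))
      open ValleyCut C
  in extendCut [ b ] (λ w → peaks-peak w a<b c<b) refl C
       (earlier , last , last-split , v<last)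

valleyCut↓ j a b []      b<a _                  a<b _ = contradiction a<b (<-asym b<a)
valleyCut↓ j a b (c ∷ r) b<a (b≢c ∷ distinct) ends j≤ with <-cmp b c
... | tri≈ _ b≡c _ = contradiction b≡c b≢c
... | tri> _ _ c<b =
  let C = valleyCut↓ j b c r c<b distinct ends (subst (λ l → j ≤ length l) (peaks-descent (c ∷ r) b<a) j≤)
      open ValleyCut C
  in extendCut [] (λ w → peaks-descent (c ∷ w) b<a) refl C
       (raise-head-last-above (peaks (b ∷ c ∷ body)) earlier b<a last-split v<last)
valleyCut↓ zero    a b (c ∷ r) b<a _                  _    _  | tri< b<c _ _ =
  valleyCut [] [] r a b c refl refl b<a b<c (peaks-descent (c ∷ r) b<a) refl [] a refl b<a
valleyCut↓ (suc j′) a b (c ∷ r) b<a (_ ∷ distinct) ends j≤ | tri< b<c _ _ =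
  let C = valleyCut↑ j′ b c r b<c distinct ends (subst (λ l → suc j′ ≤ length l) (peaks-descent (c ∷ r) b<a) j≤)
      open ValleyCut C
  in extendCut [] (λ w → peaks-descent (c ∷ w) b<a) refl C
       (a ∷ earlier , last , cong (a ∷_) last-split , v<last)

firstValley : List ℕ → ℕ
firstValley (a ∷ b ∷ r) = if b <ᵇ a then firstValley (b ∷ r) else a
firstValley (a ∷ [])    = a
firstValley []          = 0

firstValley-descent : ∀ {a b} r → b < a → firstValley (a ∷ b ∷ r) ≡ firstValley (b ∷ r)
firstValley-descent r b<a rewrite <ᵇ≡true b<a = refl

firstValley-ascent : ∀ {a b} r → a < b → firstValley (a ∷ b ∷ r) ≡ a
firstValley-ascent r a<b rewrite <ᵇ≡false (<⇒≯ a<b) = refl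

firstValley-++ : ∀ D {v u} r → Linked _>_ (D ∷ʳ v) → v < u → firstValley (D ++ v ∷ u ∷ r) ≡ v
firstValley-++ []          r _            v<u = firstValley-ascent r v<u
firstValley-++ (x ∷ [])    r (v<x ∷ _)    v<u = trans (firstValley-descent (_ ∷ r) v<x) (firstValley-ascent r v<u)
firstValley-++ (x ∷ y ∷ D) r (y<x ∷ desc) v<u =
  trans (firstValley-descent (D ++ _ ∷ _ ∷ r) y<x) (firstValley-++ (y ∷ D) r desc v<u)

descending-lower-last : ∀ D {v w} → Linked _>_ (D ∷ʳ v) → w < v → Linked _>_ (D ∷ʳ w)
descending-lower-last []          _            w<v = [-]
descending-lower-last (_ ∷ [])    (v<x ∷ _)    w<v = <-trans w<v v<x ∷ [-]
descending-lower-last (_ ∷ y ∷ D) (y<x ∷ desc) w<v = y<x ∷ descending-lower-last (y ∷ D) desc w<v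

record ValleyAfterDescent (a b : ℕ) (r : List ℕ) : Set where
  constructor valleyAfterDescent
  field
    run        : List ℕ
    v u        : ℕ
    rest       : List ℕ
    split      : b ∷ r ≡ run ++ v ∷ u ∷ rest
    descending : Linked _>_ (a ∷ run ∷ʳ v)
    v<u        : v < u

descendToValley : ∀ a b r → b < a → Linked _≢_ (b ∷ r) → EndsAscending (a ∷ b ∷ r) →
                  ValleyAfterDescent a b r
descendToValley a b []      b<a _                  a<b  = contradiction a<b (<-asym b<a)
descendToValley a b (c ∷ r) b<a (b≢c ∷ distinct) ends with <-cmp b c
... | tri< b<c _ _ = valleyAfterDescent [] b c r refl (b<a ∷ [-]) b<c
... | tri≈ _ b≡c _ = contradiction b≡c b≢c
... | tri> _ _ c<b with descendToValley b c r c<b distinct ends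
...   | valleyAfterDescent run v u rest split desc v<u =
  valleyAfterDescent (b ∷ run) v u rest (cong (b ∷_) split) (b<a ∷ desc) v<u

-- Permutations and their extended words

IsPerm⇒Unique : ∀ {n π} → IsPerm n π → Unique π
IsPerm⇒Unique {n} perm =
  Unique-resp-↭ (↭⇒↭ₛ (↭-sym perm)) (Unique.map⁺ suc-injective (Unique.upTo⁺ n))

IsPerm⇒All≤ : ∀ {n π} → IsPerm n π → All (_≤ n) π
IsPerm⇒All≤ {n} perm = All-resp-↭ (↭-sym perm) (AllP.map⁺ (AllP.all-upTo n))

IsPerm⇒length : ∀ {n π} → IsPerm n π → length π ≡ n
IsPerm⇒length {n} perm = trans (↭-length perm) (trans (length-map suc (upTo n)) (length-upTo n))

ext-unique : ∀ {n π} → IsPerm n π → Unique (ext n π)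
ext-unique {n} {π} perm =
  AllP.++⁺ (All.map (λ x≤n → <⇒≢ (s≤s x≤n) ∘ sym) bounded) (<⇒≢ (n<1+n (suc n)) ∷ [])
  ∷ Unique.++⁺ (IsPerm⇒Unique perm) ([] ∷ [])
      (λ { (x∈π , here refl) → <⇒≱ (≤-trans (n<1+n n) (n≤1+n (suc n))) (All.lookup bounded x∈π) })
  where
  bounded = IsPerm⇒All≤ perm

ext-adjacent-distinct : ∀ {n π} → IsPerm n π → Linked _≢_ (ext n π)
ext-adjacent-distinct perm = AllPairs⇒Linked (ext-unique perm)

ext-endsAscending : ∀ {n π} → IsPerm n π → EndsAscending (ext n π)
ext-endsAscending {n} {π} perm =
  EndsAscending-∷ʳ (suc n) π (n<1+n (suc n) ∷ All.map (λ x≤n → s≤s (m≤n⇒m≤1+n x≤n)) (IsPerm⇒All≤ perm))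

record FirstValleyOf (n : ℕ) (π : List ℕ) : Set where
  constructor firstValleyOf
  field
    run          : List ℕ
    a b          : ℕ
    rest         : List ℕ
    split        : π ∷ʳ suc (suc n) ≡ run ++ a ∷ b ∷ rest
    descending   : Linked _>_ (suc n ∷ run ∷ʳ a)
    a<b          : a < b
    distinct     : Linked _≢_ (b ∷ rest)
    ends         : EndsAscending (a ∷ b ∷ rest)
    pinnacles≡   : pinnacles n π ≡ peaks (a ∷ b ∷ rest)
    firstValley≡ : firstValley (ext n π) ≡ a

firstValleyOf-perm : ∀ {n x π} → IsPerm n (x ∷ π) → FirstValleyOf n (x ∷ π)
firstValleyOf-perm {n} {x} {π} perm
  with descendToValley (suc n) x (π ∷ʳ suc (suc n)) (s≤s (All.head (IsPerm⇒All≤ perm)))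
         (Linked.tail (ext-adjacent-distinct perm)) (ext-endsAscending perm)
... | valleyAfterDescent run a b rest split desc a<b =
  firstValleyOf run a b rest split desc a<b distinct ends pinnacles≡ firstValley≡
  where
  R = suc n ∷ run
  ext≡ : ext n (x ∷ π) ≡ R ++ a ∷ b ∷ rest
  ext≡ = cong (suc n ∷_) split
  distinct : Linked _≢_ (b ∷ rest)
  distinct = Linked.tail (Linked-++⁻ʳ R (subst (Linked _≢_) ext≡ (ext-adjacent-distinct perm)))
  ends : EndsAscending (a ∷ b ∷ rest)
  ends = EndsAscending-++⁻ R rest (subst EndsAscending ext≡ (ext-endsAscending perm))
  pinnacles≡ : pinnacles n (x ∷ π) ≡ peaks (a ∷ b ∷ rest)
  pinnacles≡ = begin
    peaks (ext n (x ∷ π))                           ≡⟨ cong peaks ext≡ ⟩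
    peaks (R ++ a ∷ b ∷ rest)                       ≡⟨ peaks-++ R a b rest ⟩
    peaks (R ++ a ∷ b ∷ []) ++ peaks (a ∷ b ∷ rest)
      ≡⟨ cong (_++ peaks (a ∷ b ∷ rest)) (peaks-descending-++-ascent R (Linked-∷ʳ⁻ R desc) a<b) ⟩
    peaks (a ∷ b ∷ rest)                            ∎
    where open ≡-Reasoning
  firstValley≡ : firstValley (ext n (x ∷ π)) ≡ a
  firstValley≡ = trans (cong firstValley ext≡) (firstValley-++ R rest desc a<b)

firstValley<pinnacle : ∀ {n π y ys} → IsPerm n π → pinnacles n π ≡ y ∷ ys → firstValley (ext n π) < y
firstValley<pinnacle {π = []}    _    ()
firstValley<pinnacle {π = _ ∷ _} perm eq =
  subst (_< _) (sym firstValley≡) (peaks-head-above rest a<b distinct (trans (sym pinnacles≡) eq))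
  where open FirstValleyOf (firstValleyOf-perm perm)

firstValley-below-pinnacles : ∀ {n π} → IsPerm n π → HeadAbove (firstValley (ext n π)) (pinnacles n π)
firstValley-below-pinnacles {n} {π} perm with pinnacles n π in ys≡
... | []     = _
... | _ ∷ _  = firstValley<pinnacle perm ys≡

-- Segment reversals

revSeg-segment : ∀ A s S C →
                 revSeg (length A) (length A + length S) (A ++ s ∷ S ++ C) ≡ A ++ reverse (s ∷ S) ++ C
revSeg-segment []      s S C =
  cong₂ (λ X Y → reverse (s ∷ X) ++ Y) (take-length-++ S C) (drop-length-++ S C)
revSeg-segment (x ∷ A) s S C = cong (x ∷_) (revSeg-segment A s S C)

length-segment : ∀ A s S (C : List ℕ) → length A + length S < length (A ++ s ∷ S ++ C)
length-segment []      s S C = s≤s (length-++-≤ˡ S)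
length-segment (x ∷ A) s S C = s≤s (length-segment A s S C)

↭⇒SameSet : ∀ {xs ys} → xs ↭ ys → SameSet xs ys
↭⇒SameSet xs↭ys = (λ _ → ∈-resp-↭ xs↭ys) , (λ _ → ∈-resp-↭ (↭-sym xs↭ys))

reversal-↭ : ∀ {ys ys′ : List ℕ} Yp T → ys ≡ Yp ++ T → ys′ ≡ reverse Yp ++ T → ys′ ↭ ys
reversal-↭ Yp T refl refl = ++⁺ʳ T (↭-reverse Yp)

↭⇒Balanced : ∀ {n π} i j → pinnacles n (revSeg i j π) ↭ pinnacles n π → Balanced n i j π
↭⇒Balanced i j ys′↭ys = ↭⇒SameSet (↭-sym ys′↭ys)

record SegmentReversal (n : ℕ) (π run Y Z : List ℕ) : Set where
  constructor segmentReversal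
  field
    i j   : ℕ
    i≤j   : i ≤ j
    j<n   : j < n
    perm′ : IsPerm n (revSeg i j π)
    ext≡  : ext n (revSeg i j π) ≡ (suc n ∷ run) ++ reverse Y ++ Z

reverseSegment : ∀ {n π} run a S {r₀} tail → IsPerm n π →
                 π ∷ʳ suc (suc n) ≡ run ++ (a ∷ S) ++ r₀ ∷ tail →
                 SegmentReversal n π run (a ∷ S) (r₀ ∷ tail)
reverseSegment {n} {π} run a S {r₀} tail perm split =
  segmentReversal i j (m≤m+n i (length S)) j<n perm′ ext≡
  where
  i j : ℕ
  i = length run
  j = length run + length S
  Y = a ∷ S
  Z = r₀ ∷ tail
  z = suc (suc n)
  π-split : Σ[ W ∈ List ℕ ] (π ≡ (run ++ Y) ++ W × Z ≡ W ∷ʳ z)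
  π-split = ∷ʳ-≡-++ π (run ++ Y) tail (trans split (sym (++-assoc run Y Z)))
  W = proj₁ π-split
  π≡ : π ≡ run ++ a ∷ S ++ W
  π≡ = trans (proj₁ (proj₂ π-split)) (++-assoc run Y W)
  revSeg≡ : revSeg i j π ≡ run ++ reverse Y ++ W
  revSeg≡ = trans (cong (revSeg i j) π≡) (revSeg-segment run a S W)
  j<n : j < n
  j<n = subst (j <_) (trans (cong length (sym π≡)) (IsPerm⇒length perm)) (length-segment run a S W)
  perm′ : IsPerm n (revSeg i j π)
  perm′ = subst (_↭ _) (sym revSeg≡) (↭-trans (zoom run (↭-reverse Y)) (subst (_↭ _) π≡ perm))
  ext≡ : ext n (revSeg i j π) ≡ (suc n ∷ run) ++ reverse Y ++ Z
  ext≡ = cong (suc n ∷_) (begin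
    revSeg i j π ∷ʳ z                ≡⟨ cong (_∷ʳ z) revSeg≡ ⟩
    (run ++ reverse Y ++ W) ∷ʳ z     ≡⟨ ++-assoc run (reverse Y ++ W) [ z ] ⟩
    run ++ (reverse Y ++ W) ∷ʳ z     ≡⟨ cong (run ++_) (++-assoc (reverse Y) W [ z ]) ⟩
    run ++ reverse Y ++ W ∷ʳ z       ≡⟨ cong (λ w → run ++ reverse Y ++ w) (proj₂ (proj₂ π-split)) ⟨
    run ++ reverse Y ++ Z            ∎)
    where open ≡-Reasoning

record PrefixReversal (n : ℕ) (π P : List ℕ) (y : ℕ) (T : List ℕ) : Set where
  constructor prefixReversal
  field
    i j                : ℕ
    i≤j                : i ≤ j
    j<n                : j < n
    perm′              : IsPerm n (revSeg i j π)
    pinnacles-reversed : pinnacles n (revSeg i j π) ≡ reverse (P ∷ʳ y) ++ T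
    pinnacles↭         : pinnacles n (revSeg i j π) ↭ pinnacles n π
    valley             : ℕ
    valley<y           : valley < y
    firstValley-drops  : valley < firstValley (ext n π) → firstValley (ext n (revSeg i j π)) ≡ valley

reversePrefix : ∀ {n π} → IsPerm n π → ∀ P y T → pinnacles n π ≡ P ∷ʳ y ++ T →
                HeadAbove (firstValley (ext n π)) T → PrefixReversal n π P y T
reversePrefix {π = []} _ P y T eq _ =
  contradiction (++-conicalʳ P [ y ] (++-conicalˡ (P ∷ʳ y) T (sym eq))) λ ()
reversePrefix {n} {x ∷ π} perm P y T eq above =
  prefixReversal i j i≤j j<n perm′ pinnacles-reversed (reversal-↭ (P ∷ʳ y) T eq pinnacles-reversed)
    v v<y firstValley-drops
  where
  open FirstValleyOf (firstValleyOf-perm perm)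
  open ValleyCut (valleyCut↑ (length P) a b rest a<b distinct ends
    (subst (suc (length P) ≤_) (cong length (trans (sym eq) pinnacles≡))
      (subst (_≤ length (P ∷ʳ y ++ T)) (length-∷ʳ P) (length-++-≤ˡ (P ∷ʳ y)))))
  open SegmentReversal (reverseSegment run a (b ∷ body) tail perm
                          (trans split (cong (λ r → run ++ a ∷ b ∷ r) cut)))
  Y = a ∷ b ∷ body
  peaks-split : P ∷ʳ y ≡ peaks Y × T ≡ peaks (v ∷ r₀ ∷ tail)
  peaks-split = ++-cancel-length (P ∷ʳ y) (peaks Y) (trans (length-∷ʳ P) (sym count))
                  (trans (sym eq) (trans pinnacles≡ peaks-cut))
  v<y : v < y
  v<y = subst (v <_) (sym (∷ʳ-injectiveʳ P earlier (trans (proj₁ peaks-split) last-split))) v<last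
  pinnacles-reversed : pinnacles n (revSeg i j (x ∷ π)) ≡ reverse (P ∷ʳ y) ++ T
  pinnacles-reversed = trans (cong peaks ext≡)
    (trans (peaks-reverse-valleys (suc n ∷ run) body front tail (Linked-∷ʳ⁻ (suc n ∷ run) descending)
              a<b ends-in-valley v<q v<r₀ (subst₂ HeadAbove firstValley≡ (proj₂ peaks-split) above))
           (cong₂ (λ U V → reverse U ++ V) (sym (proj₁ peaks-split)) (sym (proj₂ peaks-split))))
  firstValley-drops : v < firstValley (ext n (x ∷ π)) → firstValley (ext n (revSeg i j (x ∷ π))) ≡ v
  firstValley-drops v<fv = trans (cong firstValley ext≡)
    (trans (cong (λ w → firstValley ((suc n ∷ run) ++ w ++ r₀ ∷ tail)) (trans (cong reverse ends-in-valley) (reverse-++ front (q ∷ v ∷ []))))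
      (firstValley-++ (suc n ∷ run) (reverse front ++ r₀ ∷ tail)
        (descending-lower-last (suc n ∷ run) descending (subst (v <_) firstValley≡ v<fv)) v<q))

EndsWith : ℕ → List ℕ → Set
EndsWith M ys = Σ[ zs ∈ List ℕ ] ys ≡ zs ∷ʳ M

reversal-keeps-last : ∀ {M} Yp T → T ≢ [] → EndsWith M (Yp ++ T) → EndsWith M (reverse Yp ++ T)
reversal-keeps-last Yp []      T≢[] _         = contradiction refl T≢[]
reversal-keeps-last Yp (t ∷ T) _    (zs , eq) with ∷ʳ-≡-++ zs Yp T (sym eq)
... | W , _ , t∷T≡ = reverse Yp ++ W , trans (cong (reverse Yp ++_) t∷T≡) (sym (++-assoc (reverse Yp) W _))

-- T is nonempty: otherwise y would be the last pinnacle, hence the maximum, yet y < y₁.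
reversal-keeps-max : ∀ {M y y₁ S ys ys′} P T → y < y₁ → y₁ ∈ S → (∀ s → s ∈ S → s ≤ M) →
                     ys ≡ P ∷ʳ y ++ T → ys′ ≡ reverse (P ∷ʳ y) ++ T → EndsWith M ys → EndsWith M ys′
reversal-keeps-max {y = y} P T y<y₁ y₁∈S M-max refl refl ends = reversal-keeps-last (P ∷ʳ y) T T≢[] ends
  where
  T≢[] : T ≢ []
  T≢[] refl = <⇒≱ y<y₁ (subst (_ ≤_) (sym y≡M) (M-max _ y₁∈S))
    where y≡M = ∷ʳ-injectiveʳ P (proj₁ ends) (trans (sym (++-identityʳ (P ∷ʳ y))) (proj₂ ends))

-- Counting pinnacles below a threshold

count≤ : ℕ → List ℕ → ℕ
count≤ a xs = length (filter (_≤? a) xs)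

count≤-++ : ∀ a xs ys → count≤ a (xs ++ ys) ≡ count≤ a xs + count≤ a ys
count≤-++ a xs ys = trans (cong length (filter-++ (_≤? a) xs ys)) (length-++ (filter (_≤? a) xs))

count≤-↭ : ∀ a {xs ys} → xs ↭ ys → count≤ a xs ≡ count≤ a ys
count≤-↭ a xs↭ys = ↭-length (filter-↭ (_≤? a) xs↭ys)

count≤-length : ∀ a xs → count≤ a xs ≤ length xs
count≤-length a = length-filter (_≤? a)

count≤-∷-≤ : ∀ {a y} xs → y ≤ a → count≤ a (y ∷ xs) ≡ suc (count≤ a xs)
count≤-∷-≤ xs y≤a = cong length (filter-accept (_≤? _) y≤a)

count≤-∷-> : ∀ {a y} xs → a < y → count≤ a (y ∷ xs) ≡ count≤ a xs
count≤-∷-> xs a<y = cong length (filter-reject (_≤? _) (<⇒≱ a<y))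

count≤-mono : ∀ {a b} xs → a ≤ b → count≤ a xs ≤ count≤ b xs
count≤-mono []       a≤b = z≤n
count≤-mono {a} {b} (x ∷ xs) a≤b with x ≤? a | x ≤? b
... | yes x≤a | yes x≤b rewrite count≤-∷-≤ xs x≤a | count≤-∷-≤ xs x≤b = s≤s (count≤-mono xs a≤b)
... | yes x≤a | no  x≰b = contradiction (≤-trans x≤a a≤b) x≰b
... | no  x≰a | yes x≤b rewrite count≤-∷-> xs (≰⇒> x≰a) | count≤-∷-≤ xs x≤b = m≤n⇒m≤1+n (count≤-mono xs a≤b)
... | no  x≰a | no  x≰b rewrite count≤-∷-> xs (≰⇒> x≰a) | count≤-∷-> xs (≰⇒> x≰b) = count≤-mono xs a≤b

count≤-strict : ∀ {a b y xs} → a ≤ b → y ∈ xs → a < y → y ≤ b → count≤ a xs < count≤ b xs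
count≤-strict {a} {b} {y} {xs} a≤b y∈xs a<y y≤b with ∈-∃++ y∈xs
... | us , vs , refl = begin-strict
  count≤ a (us ++ y ∷ vs)        ≡⟨ count≤-++ a us (y ∷ vs) ⟩
  count≤ a us + count≤ a (y ∷ vs) ≡⟨ cong (count≤ a us +_) (count≤-∷-> vs a<y) ⟩
  count≤ a us + count≤ a vs      <⟨ +-mono-≤-< (count≤-mono us a≤b) (s≤s (count≤-mono vs a≤b)) ⟩
  count≤ b us + suc (count≤ b vs) ≡⟨ cong (count≤ b us +_) (count≤-∷-≤ vs y≤b) ⟨
  count≤ b us + count≤ b (y ∷ vs) ≡⟨ count≤-++ b us (y ∷ vs) ⟨
  count≤ b (us ++ y ∷ vs)        ∎
  where open ≤-Reasoning

count≤-all : ∀ a xs → length xs ≤ count≤ a xs → All (_≤ a) xs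
count≤-all a []       _ = []
count≤-all a (x ∷ xs) full with x ≤? a
... | yes x≤a = x≤a ∷ count≤-all a xs (≤-pred (subst (suc (length xs) ≤_) (count≤-∷-≤ xs x≤a) full))
... | no  x≰a = contradiction (subst (suc (length xs) ≤_) (count≤-∷-> xs (≰⇒> x≰a)) full)
                              (<⇒≱ (s≤s (count≤-length a xs)))

count≤-two : ∀ {a m b} xs ys → m ≤ a → b ≤ a → 2 ≤ count≤ a (xs ++ m ∷ b ∷ ys)
count≤-two {a} {m} {b} xs ys m≤a b≤a = begin
  2                                    ≤⟨ s≤s (s≤s z≤n) ⟩
  suc (suc (count≤ a ys))              ≡⟨ trans (count≤-∷-≤ (b ∷ ys) m≤a) (cong suc (count≤-∷-≤ ys b≤a)) ⟨
  count≤ a (m ∷ b ∷ ys)                ≤⟨ m≤n+m _ (count≤ a xs) ⟩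
  count≤ a xs + count≤ a (m ∷ b ∷ ys)  ≡⟨ count≤-++ a xs (m ∷ b ∷ ys) ⟨
  count≤ a (xs ++ m ∷ b ∷ ys)          ∎
  where open ≤-Reasoning

count≤-∷ʳ : ∀ {a y} xs → HeadAbove a (xs ∷ʳ y) → All (_≤ y) xs → count≤ a (xs ∷ʳ y) ≤ length xs ∸ 1
count≤-∷ʳ {a} {y} []      a<y _           = ≤-reflexive (count≤-∷-> [] a<y)
count≤-∷ʳ {a} {y} (w ∷ W) a<w (w≤y ∷ _) = begin
  count≤ a (w ∷ W ∷ʳ y)          ≡⟨ count≤-∷-> (W ∷ʳ y) a<w ⟩
  count≤ a (W ∷ʳ y)              ≡⟨ count≤-++ a W [ y ] ⟩
  count≤ a W + count≤ a [ y ]    ≡⟨ cong (count≤ a W +_) (count≤-∷-> [] (<-≤-trans a<w w≤y)) ⟩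
  count≤ a W + 0                 ≡⟨ +-identityʳ _ ⟩
  count≤ a W                     ≤⟨ count≤-length a W ⟩
  length W                       ∎
  where open ≤-Reasoning

-- Moving the minimum pinnacle to the front

-- The shortest prefix P ∷ʳ y ⊇ A₀ ∷ʳ m of A₀ ∷ʳ m ++ B that is followed by a letter above a
-- (or by nothing); when it is longer than A₀ ∷ʳ m, minimality puts both the letter after m
-- and y at or below a.
record GoodCut (a : ℕ) (A₀ : List ℕ) (m : ℕ) (B : List ℕ) : Set where
  constructor goodCut
  field
    P     : List ℕ
    y     : ℕ
    T     : List ℕ
    split : A₀ ∷ʳ m ++ B ≡ P ∷ʳ y ++ T
    above : HeadAbove a T
    shape : P ∷ʳ y ≡ A₀ ∷ʳ m ⊎ (Σ[ b ∈ ℕ ] Σ[ B′ ∈ List ℕ ] (B ≡ b ∷ B′ × b ≤ a)) × y ≤ a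

shortestGoodCut : ∀ a A₀ m B → GoodCut a A₀ m B
shortestGoodCut a A₀ m []      = goodCut A₀ m [] refl _ (inj₁ refl)
shortestGoodCut a A₀ m (b ∷ B) with a <? b
... | yes a<b = goodCut A₀ m (b ∷ B) refl a<b (inj₁ refl)
... | no  a≮b with shortestGoodCut a (A₀ ∷ʳ m) b B
...   | goodCut P y T split above shape =
  goodCut P y T (trans (sym (∷ʳ-++ (A₀ ∷ʳ m) b B)) split) above
    (inj₂ ((b , B , refl , ≮⇒≥ a≮b) , y≤a shape))
  where
  y≤a : P ∷ʳ y ≡ (A₀ ∷ʳ m) ∷ʳ b ⊎ (Σ[ b′ ∈ ℕ ] Σ[ B″ ∈ List ℕ ] (B ≡ b′ ∷ B″ × b′ ≤ a)) × y ≤ a → y ≤ a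
  y≤a (inj₁ eq)         = subst (_≤ a) (sym (∷ʳ-injectiveʳ P (A₀ ∷ʳ m) eq)) (≮⇒≥ a≮b)
  y≤a (inj₂ (_ , y≤a))  = y≤a

record MinToFront (n : ℕ) (π S : List ℕ) (m c : ℕ) : Set where
  constructor minToFront
  field
    rs         : List (ℕ × ℕ)
    π*         : List ℕ
    balanced   : BalSeq n π rs π*
    perm*      : IsPerm n π*
    pinnacles↭ : pinnacles n π* ↭ S
    others     : List ℕ
    min-first  : pinnacles n π* ≡ m ∷ others
    steps≤     : length rs ≤ c
    keeps-max  : ∀ {M} → (∀ s → s ∈ S → s ≤ M) → EndsWith M (pinnacles n π) → EndsWith M (pinnacles n π*)

minToFront-done : ∀ {n π S m c rest} → IsPerm n π → pinnacles n π ↭ S → pinnacles n π ≡ m ∷ rest →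
                  MinToFront n π S m c
minToFront-done {π = π} perm ys↭S first = minToFront [] π done perm ys↭S _ first z≤n (λ _ ends → ends)

minToFront-once : ∀ {n π S m c} → IsPerm n π → pinnacles n π ↭ S → IsMinOf m S → ∀ y₁ A₀ T →
                  pinnacles n π ≡ (y₁ ∷ A₀) ∷ʳ m ++ T → y₁ ≢ m →
                  PrefixReversal n π (y₁ ∷ A₀) m T → MinToFront n π S m (suc c)
minToFront-once perm ys↭S (m∈S , m-min) y₁ A₀ T ys≡ y₁≢m
                (prefixReversal i j i≤j j<n perm′ reversed ys′↭ys _ _ _) =
  minToFront ((i , j) ∷ []) _ (step i≤j j<n (↭⇒Balanced i j ys′↭ys) done) perm′
    (↭-trans ys′↭ys ys↭S) (reverse (y₁ ∷ A₀) ++ T)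
    (trans reversed (cong (_++ T) (reverse-++ (y₁ ∷ A₀) [ _ ])))
    (s≤s z≤n)
    (λ M-max → reversal-keeps-max (y₁ ∷ A₀) T m<y₁ y₁∈S M-max ys≡ reversed)
  where
  y₁∈S = ∈-resp-↭ ys↭S (subst (y₁ ∈_) (sym ys≡) (here refl))
  m<y₁ = ≤∧≢⇒< (m-min y₁ y₁∈S) (y₁≢m ∘ sym)

moveMinToFront : ∀ c {n π S m} → IsPerm n π → pinnacles n π ↭ S → IsMinOf m S → 1 ≤ c →
                 count≤ (firstValley (ext n π)) (pinnacles n π) ≤ c → MinToFront n π S m c

minToFront-recurse : ∀ c {n π S m y₁} → IsPerm n π → pinnacles n π ↭ S → IsMinOf m S → ∀ P y T →
  pinnacles n π ≡ P ∷ʳ y ++ T → y₁ ∈ S → y < y₁ → y ≤ firstValley (ext n π) →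
  2 ≤ count≤ (firstValley (ext n π)) (pinnacles n π) →
  count≤ (firstValley (ext n π)) (pinnacles n π) ≤ suc c →
  PrefixReversal n π P y T → MinToFront n π S m (suc c)
minToFront-recurse zero    _ _ _ _ _ _ _ _ _ _ two count≤c _ = contradiction (≤-trans two count≤c) λ { (s≤s ()) }
minToFront-recurse (suc c) {n} {π} perm ys↭S min P y T ys≡ y₁∈S y<y₁ y≤a₀ _ count≤c
                   (prefixReversal i j i≤j j<n perm′ reversed ys′↭ys v v<y drops) =
  minToFront ((i , j) ∷ rs) π* (step i≤j j<n (↭⇒Balanced i j ys′↭ys) balanced) perm* pinnacles↭
    others min-first (s≤s steps≤)
    (λ M-max ends → keeps-max M-max (reversal-keeps-max P T y<y₁ y₁∈S M-max ys≡ reversed ends))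
  where
  a₀ = firstValley (ext n π)
  y∈ys : y ∈ pinnacles n π
  y∈ys = subst (y ∈_) (sym ys≡) (∈-++⁺ˡ (∈-++⁺ʳ P (here refl)))
  count′ : count≤ (firstValley (ext n (revSeg i j π))) (pinnacles n (revSeg i j π)) < suc (suc c)
  count′ = begin-strict
    count≤ (firstValley (ext n (revSeg i j π))) (pinnacles n (revSeg i j π))
      ≡⟨ cong (λ w → count≤ w (pinnacles n (revSeg i j π))) (drops (<-≤-trans v<y y≤a₀)) ⟩
    count≤ v (pinnacles n (revSeg i j π))  ≡⟨ count≤-↭ v ys′↭ys ⟩
    count≤ v (pinnacles n π)              <⟨ count≤-strict (<⇒≤ (<-≤-trans v<y y≤a₀)) y∈ys v<y y≤a₀ ⟩
    count≤ a₀ (pinnacles n π)             ≤⟨ count≤c ⟩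
    suc (suc c)                           ∎
    where open ≤-Reasoning
  open MinToFront (moveMinToFront (suc c) perm′ (↭-trans ys′↭ys ys↭S) min (s≤s z≤n) (≤-pred count′))

moveMinToFront zero    _ _ _ () _
moveMinToFront (suc c) {n} {π} {S} {m} perm ys↭S min@(m∈S , m-min) _ count≤c
  with ∈-∃++ (∈-resp-↭ (↭-sym ys↭S) m∈S)
... | [] , bs , ys≡ = minToFront-done perm ys↭S ys≡
... | y₁ ∷ A₀ , bs , ys≡ with y₁ ≟ m
...   | yes refl = minToFront-done perm ys↭S ys≡
...   | no y₁≢m with shortestGoodCut (firstValley (ext n π)) (y₁ ∷ A₀) m bs
...     | goodCut P y T split above shape with shape
...       | inj₁ P∷ʳy≡ with ∷ʳ-injective P (y₁ ∷ A₀) P∷ʳy≡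
...         | refl , refl = minToFront-once perm ys↭S min y₁ A₀ T ys≡′ y₁≢m (reversePrefix perm P y T ys≡′ above)
  where ys≡′ = trans ys≡ (trans (sym (∷ʳ-++ (y₁ ∷ A₀) m bs)) split)
moveMinToFront (suc c) {n} {π} {S} {m} perm ys↭S min@(m∈S , m-min) _ count≤c
  | y₁ ∷ A₀ , _ , ys≡ | no y₁≢m | goodCut P y T split above shape | inj₂ ((b , B′ , refl , b≤a₀) , y≤a₀) =
  minToFront-recurse c perm ys↭S min P y T ys≡′ y₁∈S (≤-<-trans y≤a₀ (firstValley<pinnacle perm ys≡)) y≤a₀
    (subst (2 ≤_) (cong (count≤ _) (sym ys≡)) (count≤-two (y₁ ∷ A₀) B′ (≤-trans (m-min b b∈S) b≤a₀) b≤a₀))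
    count≤c (reversePrefix perm P y T ys≡′ above)
  where
  ys≡′ = trans ys≡ (trans (sym (∷ʳ-++ (y₁ ∷ A₀) m (b ∷ B′))) split)
  y₁∈S = ∈-resp-↭ ys↭S (subst (y₁ ∈_) (sym ys≡) (here refl))
  b∈S = ∈-resp-↭ ys↭S (subst (b ∈_) (sym ys≡) (∈-++⁺ʳ (y₁ ∷ A₀) (there (here refl))))

minimum : ∀ x xs → Σ[ m ∈ ℕ ] IsMinOf m (x ∷ xs)
minimum x []       = x , here refl , λ { _ (here refl) → ≤-refl }
minimum x (y ∷ xs) with minimum y xs
... | m , m∈ , m-min with x ≤? m
...   | yes x≤m = x , here refl , λ { _ (here refl) → ≤-refl ; s (there s∈) → ≤-trans x≤m (m-min s s∈) }
...   | no  x≰m = m , there m∈ , λ { _ (here refl) → <⇒≤ (≰⇒> x≰m) ; s (there s∈) → m-min s s∈ }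

record MinFirst (n : ℕ) (π ys : List ℕ) : Set where
  constructor minFirst
  field
    rs        : List (ℕ × ℕ)
    π*        : List ℕ
    balanced  : BalSeq n π rs π*
    perm*     : IsPerm n π*
    steps≤    : length rs ≤ length ys ∸ 1
    same      : pinnacles n π* ↭ ys
    m         : ℕ
    others    : List ℕ
    min-first : pinnacles n π* ≡ m ∷ others
    m-min     : IsMinOf m ys
    short-or-max-last : 3 ≤ length ys → length rs ≤ length ys ∸ 2 ⊎
                        Σ[ zs ∈ List ℕ ] Σ[ z ∈ ℕ ] (pinnacles n π* ≡ zs ∷ʳ z × IsMaxOf z ys)

minFirst-trivial : ∀ {n π m rest} → IsPerm n π → pinnacles n π ≡ m ∷ rest → IsMinOf m (m ∷ rest) →
                   MinFirst n π (m ∷ rest)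
minFirst-trivial {π = π} perm ys≡ min =
  minFirst [] π done perm z≤n (↭-reflexive ys≡) _ _ ys≡ min (λ _ → inj₁ z≤n)

minFirst-direct : ∀ {n π y₁ rest m} → IsPerm n π → pinnacles n π ≡ y₁ ∷ rest → IsMinOf m (y₁ ∷ rest) →
                  y₁ ≢ m → (2 ≤ length rest → count≤ (firstValley (ext n π)) rest < length rest) →
                  MinFirst n π (y₁ ∷ rest)
minFirst-direct {n} {π} {y₁} {rest} {m} perm ys≡ min@(m∈ , _) y₁≢m not-all-below =
  minFirst rs π* balanced perm* (≤-trans steps≤ c≤L) pinnacles↭
    m others min-first min (λ p≥3 → inj₁ (≤-trans steps≤ (c≤L∸1 (≤-pred p≥3))))
  where
  a₀ = firstValley (ext n π)
  c = 1 ⊔ count≤ a₀ rest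
  L≥1 : 1 ≤ length rest
  L≥1 = nonempty m∈
    where
    nonempty : m ∈ y₁ ∷ rest → 1 ≤ length rest
    nonempty (here m≡y₁)      = contradiction (sym m≡y₁) y₁≢m
    nonempty (there (here _))  = s≤s z≤n
    nonempty (there (there _)) = s≤s z≤n
  c≤L : c ≤ length rest
  c≤L = ⊔-lub L≥1 (count≤-length a₀ rest)
  c≤L∸1 : 2 ≤ length rest → c ≤ length rest ∸ 1
  c≤L∸1 L≥2 = subst (c ≤_) (pred[m∸n]≡m∸[1+n] (length rest) 0)
                (⊔-lub (suc[m]≤n⇒m≤pred[n] L≥2) (suc[m]≤n⇒m≤pred[n] (not-all-below L≥2)))
  count≡ : count≤ a₀ (pinnacles n π) ≡ count≤ a₀ rest
  count≡ = trans (cong (count≤ a₀) ys≡) (count≤-∷-> rest (firstValley<pinnacle perm ys≡))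
  open MinToFront (moveMinToFront c perm (↭-reflexive ys≡) min (m≤m⊔n 1 (count≤ a₀ rest))
                     (subst (_≤ c) (sym count≡) (m≤n⊔m 1 (count≤ a₀ rest))))

minFirst-reverseAll : ∀ {n π y₁ rest m} → IsPerm n π → pinnacles n π ≡ y₁ ∷ rest → IsMinOf m (y₁ ∷ rest) →
                      2 ≤ length rest → All (_≤ firstValley (ext n π)) rest →
                      Σ[ P ∈ List ℕ ] Σ[ y ∈ ℕ ] y₁ ∷ rest ≡ P ∷ʳ y → MinFirst n π (y₁ ∷ rest)
minFirst-reverseAll {n} {π} {y₁} {rest} {m} perm ys≡ min L≥2 below (P , y , y₁∷rest≡) =
  minFirst ((i , j) ∷ rs) π* (step i≤j j<n (↭⇒Balanced i j pinnacles↭′) balanced) perm* steps≤′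
    pinnacles↭ m others min-first min (λ _ → inj₂ (proj₁ y₁-last , y₁ , proj₂ y₁-last , here refl , y₁-max))
  where
  a₀<y₁ = firstValley<pinnacle perm ys≡
  y₁-max : ∀ s → s ∈ y₁ ∷ rest → s ≤ y₁
  y₁-max _ (here refl) = ≤-refl
  y₁-max _ (there s∈)  = <⇒≤ (≤-<-trans (All.lookup below s∈) a₀<y₁)
  open PrefixReversal (reversePrefix perm P y [] (trans ys≡ (trans y₁∷rest≡ (sym (++-identityʳ _)))) _)
    renaming (pinnacles↭ to pinnacles↭′)
  π′ = revSeg i j π
  reversed′ : pinnacles n π′ ≡ reverse rest ∷ʳ y₁
  reversed′ = trans pinnacles-reversed
    (trans (++-identityʳ _) (trans (cong reverse (sym y₁∷rest≡)) (unfold-reverse y₁ rest)))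
  a₁ = firstValley (ext n π′)
  count₁ = count≤ a₁ (pinnacles n π′)
  count₁≤ : count₁ ≤ length rest ∸ 1
  count₁≤ = begin
    count₁                               ≡⟨ cong (count≤ a₁) reversed′ ⟩
    count≤ a₁ (reverse rest ∷ʳ y₁)        ≤⟨ count≤-∷ʳ (reverse rest) a₁-below rest≤y₁ ⟩
    length (reverse rest) ∸ 1            ≡⟨ cong (_∸ 1) (length-reverse rest) ⟩
    length rest ∸ 1                      ∎
    where
    open ≤-Reasoning
    a₁-below = subst (HeadAbove a₁) reversed′ (firstValley-below-pinnacles perm′)
    rest≤y₁ = All-resp-↭ (↭-sym (↭-reverse rest)) (All.map (λ s≤a₀ → <⇒≤ (≤-<-trans s≤a₀ a₀<y₁)) below)
  c = 1 ⊔ count₁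
  c≤ : c ≤ length rest ∸ 1
  c≤ = ⊔-lub (subst (1 ≤_) (pred[m∸n]≡m∸[1+n] (length rest) 0) (suc[m]≤n⇒m≤pred[n] L≥2)) count₁≤
  open MinToFront (moveMinToFront c perm′ (↭-trans pinnacles↭′ (↭-reflexive ys≡)) min
                     (m≤m⊔n 1 count₁) (m≤n⊔m 1 count₁))
  steps≤′ : suc (length rs) ≤ length rest
  steps≤′ = subst (suc (length rs) ≤_) (m+[n∸m]≡n (≤-trans (s≤s z≤n) L≥2)) (s≤s (≤-trans steps≤ c≤))
  y₁-last = keeps-max y₁-max (reverse rest , reversed′)

exactlyOne : ∀ {L p} {Q : Set} → 2 ≤ p → L ≤ p ∸ 1 → L ≤ p ∸ 2 ⊎ Q →
             ((L ≡ p ∸ 1 × Q) ⊎ L ≤ p ∸ 2) × ¬ ((L ≡ p ∸ 1 × Q) × L ≤ p ∸ 2)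
exactlyOne {L} {suc (suc q)} {Q} (s≤s (s≤s z≤n)) L≤ short-or-Q =
  oneOf short-or-Q , λ { ((L≡ , _) , L≤′) → tight≰ L≡ L≤′ }
  where
  tight≰ : L ≡ suc q → ¬ L ≤ q
  tight≰ refl = <-irrefl refl
  oneOf : L ≤ q ⊎ Q → (L ≡ suc q × Q) ⊎ L ≤ q
  oneOf short-or-Q with L ≟ suc q | short-or-Q
  ... | yes L≡ | inj₁ L≤q = contradiction L≤q (tight≰ L≡)
  ... | yes L≡ | inj₂ q   = inj₁ (L≡ , q)
  ... | no  L≢ | _        = inj₂ (≤-pred (≤∧≢⇒< L≤ L≢))

minFirst-of : ∀ {n π y₁ rest} → IsPerm n π → pinnacles n π ≡ y₁ ∷ rest → MinFirst n π (y₁ ∷ rest)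
minFirst-of {n} {π} {y₁} {rest} perm ys≡ with minimum y₁ rest
... | m , min with y₁ ≟ m
...   | yes refl = minFirst-trivial perm ys≡ min
...   | no y₁≢m with 2 ≤? length rest | length rest ≤? count≤ (firstValley (ext n π)) rest
...     | yes L≥2 | yes all-below =
  minFirst-reverseAll perm ys≡ min L≥2 (count≤-all _ rest all-below) (unsnoc y₁ rest)
...     | yes _   | no  some-above = minFirst-direct perm ys≡ min y₁≢m (λ _ → ≰⇒> some-above)
...     | no  L≱2 | _             = minFirst-direct perm ys≡ min y₁≢m (λ L≥2 → contradiction L≥2 L≱2)

lemma1 : (n : ℕ) (π : List ℕ) → IsPerm n π → 1 ≤ length (pinnacles n π) →
  Σ[ rs ∈ List (ℕ × ℕ) ] Σ[ π* ∈ List ℕ ]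
    (BalSeq n π rs π*
     × IsPerm n π*
     × length rs ≤ length (pinnacles n π) ∸ 1
     × SameSet (pinnacles n π*) (pinnacles n π)
     × (Σ[ y ∈ ℕ ] Σ[ ys ∈ List ℕ ]
          (pinnacles n π* ≡ y ∷ ys × IsMinOf y (pinnacles n π)))
     × (3 ≤ length (pinnacles n π) →
          let p = length (pinnacles n π)
              X = (length rs ≡ p ∸ 1)
                  × (Σ[ zs ∈ List ℕ ] Σ[ z ∈ ℕ ]
                       (pinnacles n π* ≡ zs ∷ʳ z × IsMaxOf z (pinnacles n π)))
              Y = length rs ≤ p ∸ 2
          in (X ⊎ Y) × ¬ (X × Y)))
lemma1 n π perm p≥1 with pinnacles n π in ys≡
lemma1 n π perm () | []
lemma1 n π perm p≥1 | y₁ ∷ rest =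
  rs , π* , balanced , perm* , steps≤ , ↭⇒SameSet same , (m , others , min-first , m-min) ,
  λ p≥3 → exactlyOne (≤-trans (n≤1+n 2) p≥3) steps≤ (short-or-max-last p≥3)
  where open MinFirst (minFirst-of perm ys≡)
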